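{- Fix $d\geq1$ and let $X=\mathbb{N}^d$. For all $x\in X$ and all $1\leq j'<j\leq d$, we have $g_{j'}(g_j(x))=g_j(g_{j'}(x))$.
   Context: $\mathbb{N}$ denotes the nonnegative integers and $[d]=\{1,\dots,d\}$. For $x=(n_1,\dots,n_d)\in X$ let $\Delta(x)=\{(1,n_1),\dots,(d,n_d)\}\subseteq[d]\times\mathbb{N}$; conversely any set of $d$ points of $[d]\times\mathbb{N}$ with pairwise distinct first coordinates determines an element of $X$. For $\delta=(i,n)\in[d]\times\mathbb{N}$ the seat is $i(\delta)=i$ and the height is $h(\delta)=n+i/d$; points are linearly ordered by height ($\delta_1\prec\delta_2$ iff $h(\delta_1)<h(\delta_2)$). For $s\in\mathbb{N}$, $\delta+s/d$ denotes the unique point of $[d]\times\mathbb{N}$ of height $h(\delta)+s/d$. List $\Delta(x)=\{\delta^1(x)\prec\cdots\prec\delta^d(x)\}$. For $j\in[d]$, the operator $g_j:X\to X$ is defined by $g_j(x)=x'$ where $\Delta(x')=\{\delta^k(x'):k\in[d]\}$ with $\delta^k(x')=\delta^k(x)$ for $k<j$ and $\delta^k(x')=\delta^k(x)+s_k/d$ for $k\geq j$, where $s_k$ is the smallest positive integer such that $i(\delta^k(x)+s_k/d)\in\{i(\delta^j(x)),\dots,i(\delta^d(x))\}$. (In particular $g_1(n_1,\dots,n_d)=(n_d+1,n_1,\dots,n_{d-1})$.) -}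

module Defs where

open import Data.Nat using (ℕ; zero; suc; _+_; _*_; _<ᵇ_; _≤ᵇ_; NonZero; _/_)
open import Data.Nat.DivMod using (_mod_)
open import Data.Fin using (Fin; toℕ)
open import Data.Fin.Properties using () renaming (_≟_ to _≟ᶠ_)
open import Data.Bool using (Bool; true; false; if_then_else_)
open import Data.List using (List; []; _∷_; length; filterᵇ; allFin)
open import Data.Vec using (Vec; lookup; tabulate)
open import Relation.Nullary.Decidable using (⌊_⌋)

-- A point δ = (i, n) with seat i ∈ [d] (represented 0-based by k : Fin d,
-- i = toℕ k + 1) and level n is encoded by the natural number
--   code = n * d + toℕ k  =  d * h(δ) - 1 ,
-- so the encoding is a strictly increasing function of the height h(δ),
-- and  δ + s/d  is encoded by  code + s.
module _ (d : ℕ) .{{_ : NonZero d}} where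

  Point : Set
  Point = ℕ

  point : ℕ → Fin d → Point
  point n k = n * d + toℕ k

  seat : Point → Fin d
  seat m = m mod d

  level : Point → ℕ
  level m = m / d

  ptOf : Vec ℕ d → Fin d → Point
  ptOf x k = point (lookup x k) k

  -- number of points of Δ(x) strictly below the point with seat k;
  -- the point with seat k is δ^(rank+1)(x)
  rank : Vec ℕ d → Fin d → ℕ
  rank x k = length (filterᵇ (λ k' → ptOf x k' <ᵇ ptOf x k) (allFin d))

  -- seat k is among i(δ^j(x)), …, i(δ^d(x))  (j is 1-based)
  upper : ℕ → Vec ℕ d → Fin d → Bool
  upper j x k = j ≤ᵇ suc (rank x k)

  -- first s ∈ {s₀, s₀+1, …, s₀+fuel-1} with p s (returns s₀+fuel if none)
  search : (ℕ → Bool) → ℕ → ℕ → ℕ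
  search p s zero = s
  search p s (suc f) = if p s then s else search p (suc s) f

  -- s_k: smallest positive s with i(δ + s/d) ∈ {i(δ^j(x)),…,i(δ^d(x))}
  -- (it is ≤ d, since s = d returns to the same seat)
  shiftAmt : ℕ → Vec ℕ d → Point → ℕ
  shiftAmt j x m = search (λ s → upper j x (seat (m + s))) 1 d

  newPt : ℕ → Vec ℕ d → Fin d → Point
  newPt j x k = if upper j x k then ptOf x k + shiftAmt j x (ptOf x k) else ptOf x k

  findLevel : ℕ → Vec ℕ d → Fin d → List (Fin d) → ℕ
  findLevel j x c [] = 0
  findLevel j x c (k ∷ ks) =
    if ⌊ seat (newPt j x k) ≟ᶠ c ⌋ then level (newPt j x k) else findLevel j x c ks

  -- g_j(x): the element x' of X with Δ(x') = { new points }
  g : ℕ → Vec ℕ d → Vec ℕ d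
  g j x = tabulate (λ c → findLevel j x c (allFin d))

module Submission where

-- A point of Δ(x) whose seat lies in the set U of seats of δ^j(x), …, δ^d(x) is moved by g_j to
-- the next point above it with seat in U (move U); the other points stay.  This map preserves the
-- order of the points, so every point keeps its rank.  Hence, for j′ < j, g_j leaves unchanged the
-- seat set V ⊇ U of g_j′, while g_j′ turns U into its image W under move V: g_j′ ∘ g_j acts on
-- points as move V ∘ move U and g_j ∘ g_j′ as move W ∘ move V.  The two agree: for m with seat in
-- U, a point with seat in W strictly between next_V m and next_V (next_U m) would be next_V p for
-- some p with seat in U strictly between m and next_U m, and there is none.

open import Defs
open import Data.Bool using (Bool; true; false; if_then_else_; T; T?)
open import Data.Empty using (⊥-elim)
open import Data.Fin using (Fin; zero; suc; toℕ; punchOut)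
open import Data.Fin.Permutation using (Permutation; permutation)
open import Data.Fin.Properties
  using (toℕ-injective; toℕ-fromℕ<; toℕ<n; any?; injective⇒≤; punchOut-injective)
  renaming (_≟_ to _≟ᶠ_)
open import Data.List using (_∷_; length; filterᵇ; allFin)
import Data.List as List
open import Data.List.Membership.Propositional using (_∈_)
open import Data.List.Membership.Propositional.Properties using (∈-allFin)
open import Data.List.Properties using (filter-≐)
open import Data.List.Relation.Binary.Sublist.Propositional using (⊆-refl)
open import Data.List.Relation.Binary.Sublist.Propositional.Properties using (filter⁺; length-mono-≤)
open import Data.List.Relation.Unary.Any using (here; there)
open import Data.Nat
  using (ℕ; zero; suc; s≤s; _+_; _*_; _∸_; _≤_; _<_; _<ᵇ_; _≤ᵇ_; _/_; _%_; NonZero; >-nonZero⁻¹)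
open import Data.Nat.DivMod using (/-monoˡ-≤; m%n<n; [m+kn]%n≡m%n; m<n⇒m%n≡m; m≡m%n+[m/n]*n)
open import Data.Nat.Properties
open import Algebra.Properties.CommutativeMonoid.Sum +-0-commutativeMonoid using (sum; sum-permute)
open import Data.Nat.Tactic.RingSolver using (solve-∀)
open import Data.Product using (∃; _×_; _,_; proj₁; proj₂)
open import Data.Sum using (inj₁; inj₂)
open import Data.Vec using (Vec; lookup; tabulate)
open import Data.Vec.Properties using (lookup∘tabulate; tabulate∘lookup; tabulate-cong)
open import Function using (_∘_; id)
open import Function.Definitions using (Injective; StrictlySurjective)
open import Relation.Binary.Definitions using (tri<; tri≈; tri>)
open import Relation.Binary.PropositionalEquality
open import Relation.Nullary using (¬_; yes; no)

T⇒≡ : ∀ {a b} → T a → T b → a ≡ b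
T⇒≡ {true} {true} _ _ = refl

module _ {A : Set} where

  count-mono : ∀ {p q : A → Bool} → (∀ {a} → T (p a) → T (q a)) →
               ∀ xs → length (filterᵇ p xs) ≤ length (filterᵇ q xs)
  count-mono p⇒q xs = length-mono-≤ (filter⁺ _ _ (λ { refl → p⇒q }) (⊆-refl {x = xs}))

  count-cong : ∀ {p q : A → Bool} → (∀ {a} → T (p a) → T (q a)) → (∀ {a} → T (q a) → T (p a)) →
               ∀ xs → length (filterᵇ p xs) ≡ length (filterᵇ q xs)
  count-cong p⇒q q⇒p xs = cong length (filter-≐ _ _ (p⇒q , q⇒p) xs)

  count-tabulate : ∀ {n} (p : A → Bool) (f : Fin n → A) →
                   length (filterᵇ p (List.tabulate f)) ≡ sum (λ i → if p (f i) then 1 else 0)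
  count-tabulate {zero}  p f = refl
  count-tabulate {suc n} p f with p (f zero)
  ... | true  = cong suc (count-tabulate p (f ∘ suc))
  ... | false = count-tabulate p (f ∘ suc)

injective⇒strictlySurjective : ∀ {n} {σ : Fin n → Fin n} →
                               Injective _≡_ _≡_ σ → StrictlySurjective _≡_ σ
injective⇒strictlySurjective {suc n} {σ} σ-inj c with any? (λ k → σ k ≟ᶠ c)
... | yes hit = hit
... | no miss = ⊥-elim (1+n≰n (injective⇒≤ punchOut-c-injective))
  where
  c≢σ : ∀ k → c ≢ σ k
  c≢σ k e = miss (k , sym e)
  punchOut-c-injective : Injective _≡_ _≡_ (λ k → punchOut (c≢σ k))
  punchOut-c-injective e = σ-inj (punchOut-injective (c≢σ _) (c≢σ _) e)

count-allFin-permute : ∀ {n} {σ : Fin n → Fin n} → Injective _≡_ _≡_ σ → (p : Fin n → Bool) →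
                       length (filterᵇ p (allFin n)) ≡ length (filterᵇ (p ∘ σ) (allFin n))
count-allFin-permute {n} {σ} σ-inj p = begin
  length (filterᵇ p (allFin n))         ≡⟨ count-tabulate p id ⟩
  sum (λ i → if p i then 1 else 0)      ≡⟨ sum-permute _ π ⟩
  sum (λ i → if p (σ i) then 1 else 0)  ≡⟨ count-tabulate (p ∘ σ) id ⟨
  length (filterᵇ (p ∘ σ) (allFin n))   ∎
  where
  open ≡-Reasoning
  σ⁻¹ : Fin n → Fin n
  σ⁻¹ c = proj₁ (injective⇒strictlySurjective σ-inj c)
  π : Permutation n n
  π = permutation σ σ⁻¹ (λ c → proj₂ (injective⇒strictlySurjective σ-inj c))
                        (λ k → σ-inj (proj₂ (injective⇒strictlySurjective σ-inj (σ k))))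

record FirstHit (p : ℕ → Bool) (s r : ℕ) : Set where
  field
    start≤ : s ≤ r
    hit    : T (p r)
    miss   : ∀ {u} → s ≤ u → u < r → ¬ T (p u)

module Points (d : ℕ) .{{_ : NonZero d}} where

  toℕ-seat : ∀ m → toℕ (seat d m) ≡ m % d
  toℕ-seat m = toℕ-fromℕ< (m%n<n m d)

  seat-point : ∀ n k → seat d (point d n k) ≡ k
  seat-point n k = toℕ-injective (begin
    toℕ (seat d (n * d + toℕ k))  ≡⟨ toℕ-seat _ ⟩
    (n * d + toℕ k) % d           ≡⟨ cong (_% d) (+-comm (n * d) (toℕ k)) ⟩
    (toℕ k + n * d) % d           ≡⟨ [m+kn]%n≡m%n (toℕ k) n d ⟩
    toℕ k % d                     ≡⟨ m<n⇒m%n≡m (toℕ<n k) ⟩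
    toℕ k                         ∎)
    where open ≡-Reasoning

  point-level-seat : ∀ m → point d (level d m) (seat d m) ≡ m
  point-level-seat m = begin
    m / d * d + toℕ (seat d m)  ≡⟨ cong (m / d * d +_) (toℕ-seat m) ⟩
    m / d * d + m % d           ≡⟨ +-comm (m / d * d) (m % d) ⟩
    m % d + m / d * d           ≡⟨ m≡m%n+[m/n]*n m d ⟨
    m                           ∎
    where open ≡-Reasoning

  point-injective : ∀ {a b} k → point d a k ≡ point d b k → a ≡ b
  point-injective {a} {b} k e = *-cancelʳ-≡ a b d (+-cancelʳ-≡ (toℕ k) (a * d) (b * d) e)

  seat-+period : ∀ m t → seat d (m + t * d) ≡ seat d m
  seat-+period m t = toℕ-injective (begin
    toℕ (seat d (m + t * d))  ≡⟨ toℕ-seat _ ⟩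
    (m + t * d) % d           ≡⟨ [m+kn]%n≡m%n m t d ⟩
    m % d                     ≡⟨ toℕ-seat m ⟨
    toℕ (seat d m)            ∎)
    where open ≡-Reasoning

  seat-+d : ∀ m → seat d (m + d) ≡ seat d m
  seat-+d m = trans (cong (λ e → seat d (m + e)) (sym (*-identityˡ d))) (seat-+period m 1)

  seat≡⇒+period : ∀ {m m′} → seat d m ≡ seat d m′ → m ≤ m′ → ∃ λ t → m′ ≡ m + t * d
  seat≡⇒+period {m} {m′} same m≤m′ = t , (begin
    m′                     ≡⟨ point-level-seat m′ ⟨
    point d b (seat d m′)  ≡⟨ cong (point d b) same ⟨
    b * d + r              ≡⟨ cong (λ e → e * d + r) (m+[n∸m]≡n a≤b) ⟨
    (a + t) * d + r        ≡⟨ regroup a t r d ⟩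
    (a * d + r) + t * d    ≡⟨ cong (_+ t * d) (point-level-seat m) ⟩
    m + t * d              ∎)
    where
    open ≡-Reasoning
    a b r t : ℕ
    a = level d m
    b = level d m′
    r = toℕ (seat d m)
    t = b ∸ a
    a≤b : a ≤ b
    a≤b = /-monoˡ-≤ d m≤m′
    regroup : ∀ a t r n → (a + t) * n + r ≡ (a * n + r) + t * n
    regroup = solve-∀

  search-firstHit : ∀ p f s {t} → s ≤ t → t < s + f → T (p t) → FirstHit p s (search d p s f)
  search-firstHit p zero s s≤t t<s+0 _ =
    ⊥-elim (<⇒≱ t<s+0 (subst (_≤ _) (sym (+-identityʳ s)) s≤t))
  search-firstHit p (suc f) s {t} s≤t t<s+f pt with p s in ps
  ... | true  = record
    { start≤ = ≤-refl
    ; hit    = subst T (sym ps) _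
    ; miss   = λ s≤u u<s → ⊥-elim (<⇒≱ u<s s≤u)
    }
  ... | false = record
    { start≤ = <⇒≤ (FirstHit.start≤ rest)
    ; hit    = FirstHit.hit rest
    ; miss   = miss
    }
    where
    s<t : s < t
    s<t = ≤∧≢⇒< s≤t (λ { refl → subst T ps pt })
    rest : FirstHit p (suc s) (search d p (suc s) f)
    rest = search-firstHit p f (suc s) s<t (subst (t <_) (+-suc s f) t<s+f) pt
    miss : ∀ {u} → s ≤ u → u < search d p (suc s) f → ¬ T (p u)
    miss s≤u u<r with m≤n⇒m<n∨m≡n s≤u
    ... | inj₁ s<u  = FirstHit.miss rest s<u u<r
    ... | inj₂ refl = subst T ps

  search-cong : ∀ {p q : ℕ → Bool} → (∀ s → p s ≡ q s) →
                ∀ s f → search d p s f ≡ search d q s f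
  search-cong p≗q s zero = refl
  search-cong {p} {q} p≗q s (suc f) rewrite p≗q s with q s
  ... | true  = refl
  ... | false = search-cong p≗q (suc s) f

  next : (Fin d → Bool) → Point d → Point d
  next P m = m + search d (λ s → P (seat d (m + s))) 1 d

  next-cong : ∀ {P Q : Fin d → Bool} → (∀ c → P c ≡ Q c) → ∀ m → next P m ≡ next Q m
  next-cong P≗Q m = cong (m +_) (search-cong (λ s → P≗Q (seat d (m + s))) 1 d)

  next-+period : ∀ P m t → next P (m + t * d) ≡ next P m + t * d
  next-+period P m t = begin
    m + t * d + shift (m + t * d)  ≡⟨ cong (m + t * d +_) (search-cong same-seats 1 d) ⟩
    m + t * d + shift m            ≡⟨ +-assoc m (t * d) (shift m) ⟩
    m + (t * d + shift m)          ≡⟨ cong (m +_) (+-comm (t * d) (shift m)) ⟩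
    m + (shift m + t * d)          ≡⟨ +-assoc m (shift m) (t * d) ⟨
    m + shift m + t * d            ∎
    where
    open ≡-Reasoning
    shift : Point d → ℕ
    shift n = search d (λ s → P (seat d (n + s))) 1 d
    same-seats : ∀ s → P (seat d (m + t * d + s)) ≡ P (seat d (m + s))
    same-seats s = cong P (begin
      seat d (m + t * d + s)    ≡⟨ cong (seat d) (+-assoc m (t * d) s) ⟩
      seat d (m + (t * d + s))  ≡⟨ cong (λ e → seat d (m + e)) (+-comm (t * d) s) ⟩
      seat d (m + (s + t * d))  ≡⟨ cong (seat d) (+-assoc m s (t * d)) ⟨
      seat d (m + s + t * d)    ≡⟨ seat-+period (m + s) t ⟩
      seat d (m + s)            ∎)

  module _ (P : Fin d → Bool) where

    next-firstHit : ∀ {m} → T (P (seat d m)) →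
                    FirstHit (λ s → P (seat d (m + s))) 1 (search d (λ s → P (seat d (m + s))) 1 d)
    next-firstHit {m} Pm =
      search-firstHit _ d 1 (>-nonZero⁻¹ d) ≤-refl (subst (T ∘ P) (sym (seat-+d m)) Pm)

    m<next : ∀ {m} → T (P (seat d m)) → m < next P m
    m<next {m} Pm =
      subst (_≤ next P m) (+-comm m 1) (+-monoʳ-≤ m (FirstHit.start≤ (next-firstHit Pm)))

    next-hit : ∀ {m} → T (P (seat d m)) → T (P (seat d (next P m)))
    next-hit Pm = FirstHit.hit (next-firstHit Pm)

    next-miss : ∀ {m u} → T (P (seat d m)) → m < u → u < next P m → ¬ T (P (seat d u))
    next-miss {m} {u} Pm m<u u<next =
      FirstHit.miss (next-firstHit Pm) (m<n⇒0<n∸m m<u) shift<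
      ∘ subst (T ∘ P ∘ seat d) (sym m+[u∸m]≡u)
      where
      m+[u∸m]≡u : m + (u ∸ m) ≡ u
      m+[u∸m]≡u = m+[n∸m]≡n (<⇒≤ m<u)
      shift< : u ∸ m < search d (λ s → P (seat d (m + s))) 1 d
      shift< = +-cancelˡ-< m _ _ (subst (_< next P m) (sym m+[u∸m]≡u) u<next)

    next-least : ∀ {m n} → T (P (seat d m)) → m < n → T (P (seat d n)) → next P m ≤ n
    next-least Pm m<n Pn = ≮⇒≥ (λ n<next → next-miss Pm m<n n<next Pn)

    next-unique : ∀ {m n} → T (P (seat d m)) → m < n → T (P (seat d n)) →
                  (∀ {u} → m < u → u < n → ¬ T (P (seat d u))) → next P m ≡ n
    next-unique Pm m<n Pn no-P-between = ≤-antisym (next-least Pm m<n Pn)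
      (≮⇒≥ (λ next<n → no-P-between (m<next Pm) next<n (next-hit Pm)))

    next-<-mono : ∀ {a b} → T (P (seat d a)) → T (P (seat d b)) → a < b → next P a < next P b
    next-<-mono Pa Pb a<b = ≤-<-trans (next-least Pa a<b Pb) (m<next Pb)

    next-≤-mono : ∀ {a b} → T (P (seat d a)) → T (P (seat d b)) → a ≤ b → next P a ≤ next P b
    next-≤-mono Pa Pb a≤b with m≤n⇒m<n∨m≡n a≤b
    ... | inj₁ a<b  = <⇒≤ (next-<-mono Pa Pb a<b)
    ... | inj₂ refl = ≤-refl

    next-injective : ∀ {a b} → T (P (seat d a)) → T (P (seat d b)) → next P a ≡ next P b → a ≡ b
    next-injective {a} {b} Pa Pb e with <-cmp a b
    ... | tri< a<b _ _ = ⊥-elim (<-irrefl e (next-<-mono Pa Pb a<b))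
    ... | tri≈ _ a≡b _ = a≡b
    ... | tri> _ _ b<a = ⊥-elim (<-irrefl (sym e) (next-<-mono Pb Pa b<a))

    seat-next-+period : ∀ m t → seat d (next P (m + t * d)) ≡ seat d (next P m)
    seat-next-+period m t = trans (cong (seat d) (next-+period P m t)) (seat-+period (next P m) t)

    next-seat-cong : ∀ {a b} → seat d a ≡ seat d b → seat d (next P a) ≡ seat d (next P b)
    next-seat-cong {a} {b} e with ≤-total a b
    ... | inj₁ a≤b with seat≡⇒+period e a≤b
    ...   | t , refl = sym (seat-next-+period a t)
    next-seat-cong {a} {b} e | inj₂ b≤a with seat≡⇒+period (sym e) b≤a
    ...   | t , refl = seat-next-+period b t

    next-seat-injective-≤ : ∀ {a b} → T (P (seat d a)) → T (P (seat d b)) → a ≤ b →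
                            seat d (next P a) ≡ seat d (next P b) → seat d a ≡ seat d b
    next-seat-injective-≤ {a} {b} Pa Pb a≤b e with seat≡⇒+period e (next-≤-mono Pa Pb a≤b)
    ... | t , next-b≡ = trans (sym (seat-+period a t)) (cong (seat d) a+td≡b)
      where
      a+td≡b : a + t * d ≡ b
      a+td≡b = next-injective (subst (T ∘ P) (sym (seat-+period a t)) Pa) Pb
                 (trans (next-+period P a t) (sym next-b≡))

    next-seat-injective : ∀ {a b} → T (P (seat d a)) → T (P (seat d b)) →
                          seat d (next P a) ≡ seat d (next P b) → seat d a ≡ seat d b
    next-seat-injective {a} {b} Pa Pb e with ≤-total a b
    ... | inj₁ a≤b = next-seat-injective-≤ Pa Pb a≤b e
    ... | inj₂ b≤a = sym (next-seat-injective-≤ Pb Pa b≤a (sym e))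

    next-predecessor : ∀ {m n} → T (P (seat d m)) → T (P (seat d n)) → m < n →
                       ∃ λ p → T (P (seat d p)) × m ≤ p × next P p ≡ n
    next-predecessor {m} {n} Pm Pn m<n = climb n (m≤m+n n m) Pm m<n
      where
      climb : ∀ f {m} → n ≤ f + m → T (P (seat d m)) → m < n →
              ∃ λ p → T (P (seat d p)) × m ≤ p × next P p ≡ n
      climb zero n≤m _ m<n = ⊥-elim (<⇒≱ m<n n≤m)
      climb (suc f) {m} n≤ Pm m<n with m≤n⇒m<n∨m≡n (next-least Pm m<n Pn)
      ... | inj₂ next≡n = m , Pm , ≤-refl , next≡n
      ... | inj₁ next<n with climb f n≤f+next (next-hit Pm) next<n
        where
        n≤f+next : n ≤ f + next P m
        n≤f+next = ≤-trans n≤ (subst (_≤ f + next P m) (+-suc f m) (+-monoʳ-≤ f (m<next Pm)))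
      ...   | p , Pp , next≤p , next-p≡n =
        p , Pp , ≤-trans (<⇒≤ (m<next Pm)) next≤p , next-p≡n

  move : (Fin d → Bool) → Point d → Point d
  move P m = if P (seat d m) then next P m else m

  module _ (P : Fin d → Bool) where

    move-hit : ∀ {m} → T (P (seat d m)) → move P m ≡ next P m
    move-hit {m} Pm with P (seat d m)
    move-hit {m} _  | true  = refl
    move-hit {m} () | false

    move-miss : ∀ {m} → ¬ T (P (seat d m)) → move P m ≡ m
    move-miss {m} ¬Pm with P (seat d m)
    ... | true  = ⊥-elim (¬Pm _)
    ... | false = refl

    move-seat-stable : ∀ {Q : Fin d → Bool} → (∀ {c} → T (P c) → T (Q c)) →
                       ∀ m → Q (seat d (move P m)) ≡ Q (seat d m)
    move-seat-stable P⊆Q m with T? (P (seat d m))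
    ... | yes Pm rewrite move-hit Pm = T⇒≡ (P⊆Q (next-hit P Pm)) (P⊆Q Pm)
    ... | no ¬Pm rewrite move-miss ¬Pm = refl

    move-seat-cong : ∀ {a b} → seat d a ≡ seat d b → seat d (move P a) ≡ seat d (move P b)
    move-seat-cong {a} {b} e with T? (P (seat d a))
    ... | yes Pa rewrite move-hit Pa | move-hit (subst (T ∘ P) e Pa) = next-seat-cong P e
    ... | no ¬Pa rewrite move-miss ¬Pa | move-miss (¬Pa ∘ subst (T ∘ P) (sym e)) = e

    move-seat-injective : ∀ {a b} → seat d (move P a) ≡ seat d (move P b) → seat d a ≡ seat d b
    move-seat-injective {a} {b} e = from-same-P
      (trans (sym (move-seat-stable {Q = P} id a)) (trans (cong P e) (move-seat-stable {Q = P} id b)))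
      where
      from-same-P : P (seat d a) ≡ P (seat d b) → seat d a ≡ seat d b
      from-same-P same with T? (P (seat d a))
      ... | yes Pa rewrite move-hit Pa | move-hit (subst T same Pa) =
        next-seat-injective P Pa (subst T same Pa) e
      ... | no ¬Pa rewrite move-miss ¬Pa | move-miss (¬Pa ∘ subst T (sym same)) = e

    move-seat-surjective : ∀ c → ∃ λ m → seat d (move P m) ≡ c
    move-seat-surjective c with injective⇒strictlySurjective τ-injective c
      where
      τ : Fin d → Fin d
      τ c = seat d (move P (toℕ c))
      τ-injective : Injective _≡_ _≡_ τ
      τ-injective {a} {b} e = subst₂ _≡_ (seat-point 0 a) (seat-point 0 b) (move-seat-injective e)
    ... | c′ , e = toℕ c′ , e

    move-<-mono : ∀ {a b} → (T (P (seat d a)) → T (P (seat d b))) → a < b → move P a < move P b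
    move-<-mono {a} {b} upward a<b with T? (P (seat d a)) | T? (P (seat d b))
    ... | yes Pa | _      rewrite move-hit Pa | move-hit (upward Pa) =
      next-<-mono P Pa (upward Pa) a<b
    ... | no ¬Pa | yes Pb rewrite move-miss ¬Pa | move-hit Pb = <-trans a<b (m<next P Pb)
    ... | no ¬Pa | no ¬Pb rewrite move-miss ¬Pa | move-miss ¬Pb = a<b

  move-cong : ∀ {P Q : Fin d → Bool} → (∀ c → P c ≡ Q c) → ∀ m → move P m ≡ move Q m
  move-cong {P} {Q} P≗Q m rewrite P≗Q (seat d m) with Q (seat d m)
  ... | true  = next-cong P≗Q m
  ... | false = refl

  module _ {U V W : Fin d → Bool} (U⊆V : ∀ {c} → T (U c) → T (V c))
           (W-image : ∀ m → W (seat d (move V m)) ≡ U (seat d m)) where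

    W-at-next : ∀ {m} → T (U (seat d m)) → T (W (seat d (next V m)))
    W-at-next {m} Um = subst T (sym W-next≡U) Um
      where
      W-next≡U : W (seat d (next V m)) ≡ U (seat d m)
      W-next≡U = trans (cong (W ∘ seat d) (sym (move-hit V (U⊆V Um)))) (W-image m)

    W-preimage : ∀ {n} → T (W (seat d n)) →
                 ∃ λ m → T (U (seat d m)) × seat d (next V m) ≡ seat d n
    W-preimage {n} Wn with move-seat-surjective V (seat d n)
    ... | m , e = m , Um , trans (cong (seat d) (sym (move-hit V (U⊆V Um)))) e
      where
      Um : T (U (seat d m))
      Um = subst T (trans (cong W (sym e)) (W-image m)) Wn

    no-W-between : ∀ {m u} → T (U (seat d m)) → next V m < u → u < next V (next U m) →
                   ¬ T (W (seat d u))
    no-W-between {m} {u} Um below above Wu with W-preimage Wu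
    ... | m′ , Um′ , next-m′≈u
        with next-predecessor V (U⊆V Um) Vu (<-trans (m<next V (U⊆V Um)) below)
      where
      Vu : T (V (seat d u))
      Vu = subst (T ∘ V) next-m′≈u (next-hit V (U⊆V Um′))
    ...   | p , Vp , m≤p , next-p≡u = next-miss U Um m<p p<next Up
      where
      p≈m′ : seat d p ≡ seat d m′
      p≈m′ = next-seat-injective V Vp (U⊆V Um′) (trans (cong (seat d) next-p≡u) (sym next-m′≈u))
      Up : T (U (seat d p))
      Up = subst (T ∘ U) (sym p≈m′) Um′
      m<p : m < p
      m<p = ≤∧≢⇒< m≤p (λ { refl → <-irrefl next-p≡u below })
      p<next : p < next U m
      p<next = ≰⇒> (λ next≤p → <⇒≱ above (subst (next V (next U m) ≤_) next-p≡u
                 (next-≤-mono V (U⊆V (next-hit U Um)) Vp next≤p)))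

    next-comm : ∀ {m} → T (U (seat d m)) → next W (next V m) ≡ next V (next U m)
    next-comm Um = next-unique W (W-at-next Um)
      (next-<-mono V (U⊆V Um) (U⊆V (next-hit U Um)) (m<next U Um))
      (W-at-next (next-hit U Um)) (no-W-between Um)

    move-comm : ∀ m → move V (move U m) ≡ move W (move V m)
    move-comm m with T? (U (seat d m))
    ... | yes Um = begin
      move V (move U m)  ≡⟨ cong (move V) (move-hit U Um) ⟩
      move V (next U m)  ≡⟨ move-hit V (U⊆V (next-hit U Um)) ⟩
      next V (next U m)  ≡⟨ next-comm Um ⟨
      next W (next V m)  ≡⟨ move-hit W (W-at-next Um) ⟨
      move W (next V m)  ≡⟨ cong (move W) (move-hit V (U⊆V Um)) ⟨
      move W (move V m)  ∎
      where open ≡-Reasoning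
    ... | no ¬Um =
      trans (cong (move V) (move-miss U ¬Um)) (sym (move-miss W (¬Um ∘ subst T (W-image m))))

  seat-ptOf : ∀ x k → seat d (ptOf d x k) ≡ k
  seat-ptOf x k = seat-point (lookup x k) k

  ptOf-injective : ∀ x {a b} → ptOf d x a ≡ ptOf d x b → a ≡ b
  ptOf-injective x {a} {b} e = subst₂ _≡_ (seat-ptOf x a) (seat-ptOf x b) (cong (seat d) e)

  _∈Δ_ : Point d → Vec ℕ d → Set
  m ∈Δ x = ptOf d x (seat d m) ≡ m

  ptOf-∈Δ : ∀ x k → ptOf d x k ∈Δ x
  ptOf-∈Δ x k = cong (ptOf d x) (seat-ptOf x k)

  Δ-⊆⇒≡ : ∀ {x y} → (∀ {m} → m ∈Δ x → m ∈Δ y) → x ≡ y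
  Δ-⊆⇒≡ {x} {y} Δx⊆Δy = begin
    x                    ≡⟨ tabulate∘lookup x ⟨
    tabulate (lookup x)  ≡⟨ tabulate-cong same-level ⟩
    tabulate (lookup y)  ≡⟨ tabulate∘lookup y ⟩
    y                    ∎
    where
    open ≡-Reasoning
    same-level : ∀ c → lookup x c ≡ lookup y c
    same-level c = point-injective c
      (sym (subst (λ c′ → ptOf d y c′ ≡ ptOf d x c) (seat-ptOf x c) (Δx⊆Δy (ptOf-∈Δ x c))))

  rank-mono : ∀ x {a b} → ptOf d x a < ptOf d x b → rank d x a ≤ rank d x b
  rank-mono x a<b = count-mono (λ below-a → <⇒<ᵇ (<-trans (<ᵇ⇒< _ _ below-a) a<b)) (allFin d)

  upper-upward : ∀ j x {a b} → ptOf d x a < ptOf d x b →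
                 T (upper d j x a) → T (upper d j x b)
  upper-upward j x a<b ja = ≤⇒≤ᵇ (≤-trans (≤ᵇ⇒≤ j _ ja) (s≤s (rank-mono x a<b)))

  upper-antitone : ∀ {j₂ j} x {c} → j₂ ≤ j → T (upper d j x c) → T (upper d j₂ x c)
  upper-antitone {j₂} {j} x j₂≤j jc = ≤⇒≤ᵇ (≤-trans j₂≤j (≤ᵇ⇒≤ j _ jc))

  module Step (j : ℕ) (x : Vec ℕ d) where

    newPt≡move : ∀ k → newPt d j x k ≡ move (upper d j x) (ptOf d x k)
    newPt≡move k = cong (λ b → if b then next (upper d j x) (ptOf d x k) else ptOf d x k)
                        (cong (upper d j x) (sym (seat-ptOf x k)))

    newPt-<-mono : ∀ {a b} → ptOf d x a < ptOf d x b → newPt d j x a < newPt d j x b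
    newPt-<-mono {a} {b} a<b rewrite newPt≡move a | newPt≡move b =
      move-<-mono (upper d j x) upward a<b
      where
      upward : T (upper d j x (seat d (ptOf d x a))) → T (upper d j x (seat d (ptOf d x b)))
      upward rewrite seat-ptOf x a | seat-ptOf x b = upper-upward j x a<b

    newPt-<-reflects : ∀ {a b} → newPt d j x a < newPt d j x b → ptOf d x a < ptOf d x b
    newPt-<-reflects {a} {b} lt with <-cmp (ptOf d x a) (ptOf d x b)
    ... | tri< a<b _ _ = a<b
    ... | tri≈ _ a≡b _ = ⊥-elim (<-irrefl (cong (newPt d j x) (ptOf-injective x a≡b)) lt)
    ... | tri> _ _ b<a = ⊥-elim (<-asym lt (newPt-<-mono b<a))

    newSeat : Fin d → Fin d
    newSeat k = seat d (newPt d j x k)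

    newSeat-injective : Injective _≡_ _≡_ newSeat
    newSeat-injective {a} {b} e rewrite newPt≡move a | newPt≡move b =
      subst₂ _≡_ (seat-ptOf x a) (seat-ptOf x b) (move-seat-injective (upper d j x) e)

    findLevel-∈ : ∀ {k ks} → k ∈ ks → findLevel d j x (newSeat k) ks ≡ level d (newPt d j x k)
    findLevel-∈ {k} {k′ ∷ ks} k∈ with newSeat k′ ≟ᶠ newSeat k
    ... | yes e = cong (level d ∘ newPt d j x) (newSeat-injective e)
    ... | no ne with k∈
    ...   | here refl  = ⊥-elim (ne refl)
    ...   | there k∈ks = findLevel-∈ k∈ks

    ptOf-g : ∀ k → ptOf d (g d j x) (newSeat k) ≡ newPt d j x k
    ptOf-g k = begin
      point d (lookup (g d j x) (newSeat k)) (newSeat k)  ≡⟨ cong (λ n → point d n (newSeat k)) level≡ ⟩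
      point d (level d (newPt d j x k)) (newSeat k)       ≡⟨ point-level-seat (newPt d j x k) ⟩
      newPt d j x k                                       ∎
      where
      open ≡-Reasoning
      level≡ : lookup (g d j x) (newSeat k) ≡ level d (newPt d j x k)
      level≡ = trans (lookup∘tabulate _ (newSeat k)) (findLevel-∈ (∈-allFin k))

    rank-g : ∀ k → rank d (g d j x) (newSeat k) ≡ rank d x k
    rank-g k = begin
      rank d (g d j x) (newSeat k)
        ≡⟨ count-allFin-permute newSeat-injective _ ⟩
      length (filterᵇ (λ k′ → ptOf d (g d j x) (newSeat k′) <ᵇ ptOf d (g d j x) (newSeat k)) (allFin d))
        ≡⟨ count-cong (<⇒<ᵇ ∘ newPt-<-reflects ∘ <ᵇ⇒< _ _ ∘ subst T order≡)
                      (subst T (sym order≡) ∘ <⇒<ᵇ ∘ newPt-<-mono ∘ <ᵇ⇒< _ _) (allFin d) ⟩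
      rank d x k
        ∎
      where
      open ≡-Reasoning
      order≡ : ∀ {k′} → (ptOf d (g d j x) (newSeat k′) <ᵇ ptOf d (g d j x) (newSeat k))
                      ≡ (newPt d j x k′ <ᵇ newPt d j x k)
      order≡ {k′} = cong₂ _<ᵇ_ (ptOf-g k′) (ptOf-g k)

    upper-g : ∀ j₂ m →
              upper d j₂ (g d j x) (seat d (move (upper d j x) m)) ≡ upper d j₂ x (seat d m)
    upper-g j₂ m = begin
      upper d j₂ (g d j x) (seat d (move (upper d j x) m))
        ≡⟨ cong (upper d j₂ (g d j x)) (move-seat-cong (upper d j x) (sym (seat-ptOf x k))) ⟩
      upper d j₂ (g d j x) (seat d (move (upper d j x) (ptOf d x k)))
        ≡⟨ cong (upper d j₂ (g d j x) ∘ seat d) (newPt≡move k) ⟨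
      upper d j₂ (g d j x) (newSeat k)
        ≡⟨ cong (λ r → j₂ ≤ᵇ suc r) (rank-g k) ⟩
      upper d j₂ x k
        ∎
      where
      open ≡-Reasoning
      k : Fin d
      k = seat d m

    upper-g-≤ : ∀ {j₂} → j₂ ≤ j → ∀ c → upper d j₂ (g d j x) c ≡ upper d j₂ x c
    upper-g-≤ {j₂} j₂≤j c with move-seat-surjective (upper d j x) c
    ... | m , refl = trans (upper-g j₂ m)
      (sym (move-seat-stable (upper d j x) (λ {c} → upper-antitone x {c} j₂≤j) m))

    ∈Δ-g : ∀ {m} → m ∈Δ x → move (upper d j x) m ∈Δ g d j x
    ∈Δ-g {m} m∈Δx = subst (λ n → move (upper d j x) n ∈Δ g d j x) m∈Δx image-∈Δ
      where
      image-∈Δ : move (upper d j x) (ptOf d x (seat d m)) ∈Δ g d j x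
      image-∈Δ = subst (_∈Δ g d j x) (newPt≡move (seat d m)) (ptOf-g (seat d m))

    ∈Δ-g⁻¹ : ∀ {m} → m ∈Δ g d j x → ∃ λ m′ → m′ ∈Δ x × move (upper d j x) m′ ≡ m
    ∈Δ-g⁻¹ {m} m∈Δgx with injective⇒strictlySurjective newSeat-injective (seat d m)
    ... | k , newSeat-k≡ = ptOf d x k , ptOf-∈Δ x k , (begin
      move (upper d j x) (ptOf d x k)  ≡⟨ newPt≡move k ⟨
      newPt d j x k                    ≡⟨ ptOf-g k ⟨
      ptOf d (g d j x) (newSeat k)     ≡⟨ cong (ptOf d (g d j x)) newSeat-k≡ ⟩
      ptOf d (g d j x) (seat d m)      ≡⟨ m∈Δgx ⟩
      m                                ∎)
      where open ≡-Reasoning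

theorem4p1 : (d : ℕ) .{{_ : NonZero d}} (x : Vec ℕ d) (j′ j : ℕ) →
             1 ≤ j′ → j′ < j → j ≤ d →
             g d j′ (g d j x) ≡ g d j (g d j′ x)
theorem4p1 d x j′ j _ j′<j _ = Δ-⊆⇒≡ Δ-image
  where
  open Points d

  U V W V′ : Fin d → Bool
  U  = upper d j x
  V  = upper d j′ x
  W  = upper d j (g d j′ x)
  V′ = upper d j′ (g d j x)

  moves-commute : ∀ m → move V′ (move U m) ≡ move W (move V m)
  moves-commute m = begin
    move V′ (move U m) ≡⟨ move-cong (Step.upper-g-≤ j x (<⇒≤ j′<j)) (move U m) ⟩
    move V (move U m)  ≡⟨ move-comm {U} {V} {W} (upper-antitone x (<⇒≤ j′<j)) (Step.upper-g j′ x j) m ⟩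
    move W (move V m)  ∎
    where open ≡-Reasoning

  Δ-image : ∀ {m} → m ∈Δ g d j′ (g d j x) → m ∈Δ g d j (g d j′ x)
  Δ-image m∈Δ =
    let m₁ , m₁∈Δ , moved₁ = Step.∈Δ-g⁻¹ j′ (g d j x) m∈Δ
        m₀ , m₀∈Δ , moved₀ = Step.∈Δ-g⁻¹ j x m₁∈Δ
    in subst (_∈Δ g d j (g d j′ x))
             (trans (sym (moves-commute m₀)) (trans (cong (move V′) moved₀) moved₁))
             (Step.∈Δ-g j (g d j′ x) (Step.∈Δ-g j′ x m₀∈Δ))
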